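{- Let $k\ge 2$ and let $E\subset\mathbb{N}_0$ be $k$-arid of rank exactly $r$ (i.e., $k$-arid of rank $\le r$ but not of rank $\le r-1$). Then $$\max_{M\in\mathbb{N}_0}|E\cap[M,M+N)| = O(\log^r N)\quad\text{as } N\to\infty.$$
   Context: $\Sigma_k=\{0,\dots,k-1\}$, $\Sigma_k^*$ is the set of finite words over $\Sigma_k$, and $[w]_k$ is the integer whose base-$k$ expansion is $w$ (leading zeros allowed). A basic $k$-arid set of rank $\le r$ is $\{v_0w_1^{l_1}v_1\cdots w_r^{l_r}v_r: l_1,\dots,l_r\in\mathbb{N}_0\}$ with $v_i,w_i\in\Sigma_k^*$; a $k$-arid set of words (of rank $\le r$) is a finite union of such basic sets (of rank $\le r$). A set $E\subset\mathbb{N}_0$ is $k$-arid of rank $\le r$ if $E=\{[u]_k:u\in A\}$ for some $k$-arid $A\subset\Sigma_k^*$ of rank $\le r$. -}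

module Defs where

open import Data.Nat using (ℕ; zero; suc; _+_; _*_; _^_; _≤_; _<_)
open import Data.Nat.Logarithm using (⌊log₂_⌋)
open import Data.Fin using (Fin; toℕ)
open import Data.List using (List; []; _∷_; _++_; foldl; concat; replicate; length)
open import Data.List.Relation.Unary.All using (All)
open import Data.List.Relation.Unary.Any using (Any)
open import Data.List.Relation.Unary.Unique.Propositional using (Unique)
open import Data.Vec using (Vec; []; _∷_)
open import Data.Product using (Σ; ∃; _×_; _,_)
open import Relation.Binary.PropositionalEquality using (_≡_)
open import Relation.Nullary using (¬_)

Word : ℕ → Set
Word k = List (Fin k)

-- [w]_k : the integer with base-k expansion w (most significant digit first,
-- leading zeros allowed; the empty word has value 0)
val : (k : ℕ) → Word k → ℕ
val k = foldl (λ acc d → acc * k + toℕ d) 0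

pow : ∀ {k} → ℕ → Word k → Word k
pow l w = concat (replicate l w)

expand : ∀ {k r} → Vec (Word k) (suc r) → Vec (Word k) r → Vec ℕ r → Word k
expand (v₀ ∷ []) [] [] = v₀
expand (v₀ ∷ vs@(_ ∷ _)) (w ∷ ws) (l ∷ ls) = v₀ ++ pow l w ++ expand vs ws ls

record Basic (k : ℕ) : Set where
  constructor basic
  field
    rank : ℕ
    vs   : Vec (Word k) (suc rank)
    ws   : Vec (Word k) rank

InBasic : ∀ {k} → Basic k → Word k → Set
InBasic b u = ∃ λ (ls : Vec ℕ (Basic.rank b)) → u ≡ expand (Basic.vs b) (Basic.ws b) ls

InArid : ∀ {k} → List (Basic k) → Word k → Set
InArid bs u = Any (λ b → InBasic b u) bs

IsAridRank≤ : (k r : ℕ) → (ℕ → Set) → Set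
IsAridRank≤ k r E =
  Σ (List (Basic k)) λ bs →
    All (λ b → Basic.rank b ≤ r) bs ×
    (∀ n → (E n → ∃ λ u → InArid bs u × val k u ≡ n) ×
           ((∃ λ u → InArid bs u × val k u ≡ n) → E n))

IsAridRankExactly : (k r : ℕ) → (ℕ → Set) → Set
IsAridRankExactly k r E = IsAridRank≤ k r E × (∀ r' → r' < r → ¬ IsAridRank≤ k r' E)

-- |E ∩ [M, M+N)| ≤ B : every duplicate-free list of elements of E ∩ [M, M+N)
-- has length ≤ B
CountInWindow≤ : (ℕ → Set) → (M N B : ℕ) → Set
CountInWindow≤ E M N B =
  (xs : List ℕ) → Unique xs → All (λ x → E x × M ≤ x × x < M + N) xs → length xs ≤ B

module Submission where

-- Fix a window length N ≥ 2 and put L = ⌊log₂ N⌋, j = L + 1 and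
-- K = k ^ j, so that N < 2 ^ j ≤ K.  Every x decomposes as x = x % K + (x / K) * K.
-- For x in a window [M, M + N) the quotient x / K is M / K or M / K + 1, and
-- for x = [u]_k the residue x % K is the value of the length-j suffix of u.
-- So the window meets E in at most 2 S elements, S being the number of
-- length-j suffixes of words of the arid set.  For words v w^l the length-t
-- suffix is already attained for some l ≤ t (for longer powers only w^t
-- matters); peeling the blocks off a basic set v₀ w₁^l₁ ⋯ w_r^l_r v_r from the
-- right therefore leaves at most (j + 1)^r suffixes, and the finite union has
-- S ≤ |bs| (j + 1)^r.  As (L + 2)^r ≤ 3^r L^r for L ≥ 1 the window count is at
-- most 2 |bs| 3^r L^r.

open import Defs
open import Data.Nat using (ℕ; _*_; _^_; _≤_)
open import Data.Nat.Logarithm using (⌊log₂_⌋)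
open import Data.Product using (∃₂)

open import Data.Nat using (zero; suc; _+_; _∸_; _<_; z≤n; s≤s; NonZero; >-nonZero)
open import Data.Nat.Properties
open import Data.Nat.DivMod
  using (_/_; _%_; m≡m%n+[m/n]*n; [m+kn]%n≡m%n; m<n⇒m%n≡m; /-monoˡ-≤; m/n≡1+[m∸n]/n)
open import Data.Nat.Logarithm using (⌊log₂⌋-mono-≤; ⌊log₂[2^n]⌋≡n)
open import Data.Nat.Tactic.RingSolver using (solve-∀)
open import Data.Fin using (toℕ)
open import Data.Fin.Properties using (toℕ<n)
open import Data.List using (List; []; _∷_; _++_; foldl; concatMap; length; take; drop; map; upTo)
open import Data.List.Properties
  using (length-++; foldl-++; ++-assoc; take++drop≡id; length-drop; drop-all; length-upTo; length-map; length-removeAt′)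
open import Data.List.Membership.Propositional using (_∈_; lose; find)
open import Data.List.Membership.Propositional.Properties using (∈-map⁺; ∈-upTo⁺; ∈-concatMap⁺)
open import Data.List.Relation.Unary.Any using (here; there; _─_)
open import Data.List.Relation.Unary.All using (All; _∷_) renaming (lookup to All-lookup)
open import Data.List.Relation.Unary.AllPairs using (_∷_)
open import Data.List.Relation.Unary.Unique.Propositional using (Unique)
open import Data.Vec using (Vec; []; _∷_)
open import Data.Product using (∃; _×_; _,_; proj₁)
open import Data.Sum using (_⊎_; inj₁; inj₂) renaming ([_,_]′ to either)
open import Relation.Binary.PropositionalEquality
open import Relation.Nullary using (¬_; yes; no)
open import Data.Empty using (⊥-elim)
open import Function using (_∘_)

foldl-val : ∀ k acc (b : Word k) →
  foldl (λ acc d → acc * k + toℕ d) acc b ≡ acc * k ^ length b + val k b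
foldl-val k acc [] = sym (trans (+-identityʳ _) (*-identityʳ acc))
foldl-val k acc (d ∷ b) = begin
    step (acc * k + toℕ d) b
  ≡⟨ foldl-val k (acc * k + toℕ d) b ⟩
    (acc * k + toℕ d) * k ^ length b + val k b
  ≡⟨ shift acc k (toℕ d) (k ^ length b) (val k b) ⟩
    acc * (k * k ^ length b) + ((0 * k + toℕ d) * k ^ length b + val k b)
  ≡⟨ cong (acc * (k * k ^ length b) +_) (sym (foldl-val k (0 * k + toℕ d) b)) ⟩
    acc * (k * k ^ length b) + step (0 * k + toℕ d) b
  ∎
  where
  open ≡-Reasoning
  step : ℕ → Word k → ℕ
  step = foldl (λ acc d → acc * k + toℕ d)
  shift : ∀ a k d P V → (a * k + d) * P + V ≡ a * (k * P) + ((0 * k + d) * P + V)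
  shift = solve-∀

val-++ : ∀ k (a b : Word k) → val k (a ++ b) ≡ val k a * k ^ length b + val k b
val-++ k a b = trans (foldl-++ (λ acc d → acc * k + toℕ d) 0 a b) (foldl-val k (val k a) b)

val< : ∀ k (u : Word k) → val k u < k ^ length u
val< k [] = s≤s z≤n
val< k (d ∷ u) = begin-strict
    val k (d ∷ u)
  ≡⟨ foldl-val k (0 * k + toℕ d) u ⟩
    toℕ d * P + val k u
  <⟨ +-monoʳ-< (toℕ d * P) (val< k u) ⟩
    toℕ d * P + P
  ≡⟨ +-comm (toℕ d * P) P ⟩
    suc (toℕ d) * P
  ≤⟨ *-monoˡ-≤ P (toℕ<n d) ⟩
    k * P
  ∎
  where
  open ≤-Reasoning
  P : ℕ
  P = k ^ length u

-- Suffixes of lists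

module _ {A : Set} where

  -- The suffix of length j of u (all of u if u is shorter).
  suffix : ℕ → List A → List A
  suffix j u = drop (length u ∸ j) u

  drop-++ : ∀ n (x y : List A) → drop n (x ++ y) ≡ drop n x ++ drop (n ∸ length x) y
  drop-++ zero x y rewrite 0∸n≡0 (length x) = refl
  drop-++ (suc n) [] y = refl
  drop-++ (suc n) (a ∷ x) y = drop-++ n x y

  suffix-short : ∀ j (u : List A) → length u ≤ j → suffix j u ≡ u
  suffix-short j u p rewrite m≤n⇒m∸n≡0 p = refl

  length-suffix-long : ∀ j (u : List A) → j ≤ length u → length (suffix j u) ≡ j
  length-suffix-long j u p = trans (length-drop (length u ∸ j) u) (m∸[m∸n]≡n p)

  length-suffix≤ : ∀ j (u : List A) → length (suffix j u) ≤ j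
  length-suffix≤ j u with ≤-total j (length u)
  ... | inj₁ j≤u = ≤-reflexive (length-suffix-long j u j≤u)
  ... | inj₂ u≤j = subst (λ z → length z ≤ j) (sym (suffix-short j u u≤j)) u≤j

  suffix-zero : ∀ (u : List A) → suffix 0 u ≡ []
  suffix-zero u = drop-all (length u) u ≤-refl

  suffix-++-long : ∀ j (x y : List A) → j ≤ length y → suffix j (x ++ y) ≡ suffix j y
  suffix-++-long j x y p = begin
      drop (length (x ++ y) ∸ j) (x ++ y)
    ≡⟨ cong (λ n → drop n (x ++ y)) offset ⟩
      drop (length x + (length y ∸ j)) (x ++ y)
    ≡⟨ drop-++ (length x + (length y ∸ j)) x y ⟩
      drop (length x + (length y ∸ j)) x ++ drop (length x + (length y ∸ j) ∸ length x) y
    ≡⟨ cong₂ _++_ (drop-all _ x (m≤m+n (length x) _)) (cong (λ n → drop n y) (m+n∸m≡n (length x) _)) ⟩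
      suffix j y
    ∎
    where
    open ≡-Reasoning
    offset : length (x ++ y) ∸ j ≡ length x + (length y ∸ j)
    offset = trans (cong (_∸ j) (length-++ x)) (+-∸-assoc (length x) p)

  suffix-++-short : ∀ j (x y : List A) → length y ≤ j → suffix j (x ++ y) ≡ suffix (j ∸ length y) x ++ y
  suffix-++-short j x y p = begin
      drop (length (x ++ y) ∸ j) (x ++ y)
    ≡⟨ cong (λ n → drop n (x ++ y)) offset ⟩
      drop n (x ++ y)
    ≡⟨ drop-++ n x y ⟩
      drop n x ++ drop (n ∸ length x) y
    ≡⟨ cong (λ m → drop n x ++ drop m y) (m≤n⇒m∸n≡0 (m∸n≤m (length x) (j ∸ length y))) ⟩
      drop n x ++ y
    ∎
    where
    open ≡-Reasoning
    n : ℕ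
    n = length x ∸ (j ∸ length y)
    offset : length (x ++ y) ∸ j ≡ n
    offset = begin
        length (x ++ y) ∸ j
      ≡⟨ cong₂ _∸_ (length-++ x) (sym (m+[n∸m]≡n p)) ⟩
        length x + length y ∸ (length y + (j ∸ length y))
      ≡⟨ sym (∸-+-assoc (length x + length y) (length y) (j ∸ length y)) ⟩
        length x + length y ∸ length y ∸ (j ∸ length y)
      ≡⟨ cong (_∸ (j ∸ length y)) (m+n∸n≡m (length x) (length y)) ⟩
        n
      ∎

  suffix-++ : ∀ j (x y : List A) → suffix j (x ++ y) ≡ suffix (j ∸ length (suffix j y)) x ++ suffix j y
  suffix-++ j x y with ≤-total j (length y)
  ... | inj₁ j≤y = begin
      suffix j (x ++ y)
    ≡⟨ suffix-++-long j x y j≤y ⟩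
      suffix j y
    ≡⟨ cong (_++ suffix j y) (sym (suffix-zero x)) ⟩
      suffix 0 x ++ suffix j y
    ≡⟨ cong (λ t → suffix t x ++ suffix j y) (sym (trans (cong (j ∸_) (length-suffix-long j y j≤y)) (n∸n≡0 j))) ⟩
      suffix (j ∸ length (suffix j y)) x ++ suffix j y
    ∎
    where open ≡-Reasoning
  ... | inj₂ y≤j rewrite suffix-short j y y≤j = suffix-++-short j x y y≤j

-- Suffixes of powers

length-pow : ∀ {k} l (w : Word k) → length (pow l w) ≡ l * length w
length-pow zero w = refl
length-pow (suc l) w = trans (length-++ w) (cong (length w +_) (length-pow l w))

pow-+ : ∀ {k} m l (w : Word k) → pow (m + l) w ≡ pow m w ++ pow l w
pow-+ zero l w = refl
pow-+ (suc m) l w = trans (cong (w ++_) (pow-+ m l w)) (sym (++-assoc w (pow m w) (pow l w)))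

pow-[] : ∀ {k} l → pow {k} l [] ≡ []
pow-[] zero = refl
pow-[] (suc l) = pow-[] l

suffix-pow-stable : ∀ {k} t l (v w : Word k) → t ≤ l → suffix t (v ++ pow l w) ≡ suffix t (v ++ pow t w)
suffix-pow-stable t l v [] t≤l = cong (λ z → suffix t (v ++ z)) (trans (pow-[] l) (sym (pow-[] t)))
suffix-pow-stable t l v w@(_ ∷ _) t≤l = begin
    suffix t (v ++ pow l w)
  ≡⟨ cong (λ z → suffix t (v ++ z)) (trans (cong (λ e → pow e w) (sym (m∸n+n≡m t≤l))) (pow-+ (l ∸ t) t w)) ⟩
    suffix t (v ++ pow (l ∸ t) w ++ pow t w)
  ≡⟨ cong (suffix t) (sym (++-assoc v (pow (l ∸ t) w) (pow t w))) ⟩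
    suffix t ((v ++ pow (l ∸ t) w) ++ pow t w)
  ≡⟨ suffix-++-long t _ (pow t w) t≤|wᵗ| ⟩
    suffix t (pow t w)
  ≡⟨ sym (suffix-++-long t v (pow t w) t≤|wᵗ|) ⟩
    suffix t (v ++ pow t w)
  ∎
  where
  open ≡-Reasoning
  t≤|wᵗ| : t ≤ length (pow t w)
  t≤|wᵗ| = subst (t ≤_) (sym (length-pow t w)) (m≤m*n t (length w))

-- The length-t suffixes of v w^l, l ∈ ℕ: those with l ≤ t.
powerSuffixes : ∀ {k} → ℕ → Word k → Word k → List (Word k)
powerSuffixes t v w = map (λ l → suffix t (v ++ pow l w)) (upTo (suc t))

length-powerSuffixes : ∀ {k} t (v w : Word k) → length (powerSuffixes t v w) ≡ suc t
length-powerSuffixes t v w = trans (length-map _ (upTo (suc t))) (length-upTo (suc t))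

powerSuffixes-complete : ∀ {k} t (v w : Word k) l → suffix t (v ++ pow l w) ∈ powerSuffixes t v w
powerSuffixes-complete t v w l with ≤-total l t
... | inj₁ l≤t = ∈-map⁺ (λ l → suffix t (v ++ pow l w)) (∈-upTo⁺ (s≤s l≤t))
... | inj₂ t≤l = subst (_∈ powerSuffixes t v w) (sym (suffix-pow-stable t l v w t≤l))
                   (∈-map⁺ (λ l → suffix t (v ++ pow l w)) (∈-upTo⁺ ≤-refl))

-- Suffixes of arid sets

-- Candidates for the length-j suffix of v w^l z when z has length-j suffix y.
blockSuffixes : ∀ {k} j (v w y : Word k) → List (Word k)
blockSuffixes j v w y = map (_++ y) (powerSuffixes (j ∸ length y) v w)

length-blockSuffixes : ∀ {k} j (v w y : Word k) → length (blockSuffixes j v w y) ≤ suc j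
length-blockSuffixes j v w y = begin
    length (blockSuffixes j v w y)
  ≡⟨ length-map (_++ y) (powerSuffixes (j ∸ length y) v w) ⟩
    length (powerSuffixes (j ∸ length y) v w)
  ≡⟨ length-powerSuffixes (j ∸ length y) v w ⟩
    suc (j ∸ length y)
  ≤⟨ s≤s (m∸n≤m j (length y)) ⟩
    suc j
  ∎
  where open ≤-Reasoning

basicSuffixes : ∀ {k} j {r} → Vec (Word k) (suc r) → Vec (Word k) r → List (Word k)
basicSuffixes j (v ∷ []) [] = suffix j v ∷ []
basicSuffixes j (v ∷ vs) (w ∷ ws) = concatMap (blockSuffixes j v w) (basicSuffixes j vs ws)

basicSuffixes-complete : ∀ {k} j {r} (vs : Vec (Word k) (suc r)) ws (ls : Vec ℕ r) →
  suffix j (expand vs ws ls) ∈ basicSuffixes j vs ws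
basicSuffixes-complete j (v ∷ []) [] [] = here refl
basicSuffixes-complete {k} j (v ∷ vs@(_ ∷ _)) (w ∷ ws) (l ∷ ls) =
  subst (_∈ basicSuffixes j (v ∷ vs) (w ∷ ws)) (sym split)
    (∈-concatMap⁺ (blockSuffixes j v w) (lose (basicSuffixes-complete j vs ws ls)
      (∈-map⁺ (_++ y′) (powerSuffixes-complete (j ∸ length y′) v w l))))
  where
  y : Word k
  y = expand vs ws ls
  y′ : Word k
  y′ = suffix j y
  split : suffix j (v ++ pow l w ++ y) ≡ suffix (j ∸ length y′) (v ++ pow l w) ++ y′
  split = trans (cong (suffix j) (sym (++-assoc v (pow l w) y))) (suffix-++ j (v ++ pow l w) y)

aridSuffixes : ∀ {k} → ℕ → List (Basic k) → List (Word k)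
aridSuffixes j = concatMap (λ b → basicSuffixes j (Basic.vs b) (Basic.ws b))

aridSuffixes-complete : ∀ {k} j (bs : List (Basic k)) {u} → InArid bs u → suffix j u ∈ aridSuffixes j bs
aridSuffixes-complete j bs u∈ with find u∈
... | b , b∈ , ls , refl =
  ∈-concatMap⁺ (λ b → basicSuffixes j (Basic.vs b) (Basic.ws b))
    (lose b∈ (basicSuffixes-complete j (Basic.vs b) (Basic.ws b) ls))

-- Counting

length-concatMap≤ : ∀ {A B : Set} (f : A → List B) c (xs : List A) →
  (∀ {x} → x ∈ xs → length (f x) ≤ c) → length (concatMap f xs) ≤ length xs * c
length-concatMap≤ f c [] bound = z≤n
length-concatMap≤ f c (x ∷ xs) bound = begin
    length (f x ++ concatMap f xs)
  ≡⟨ length-++ (f x) ⟩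
    length (f x) + length (concatMap f xs)
  ≤⟨ +-mono-≤ (bound (here refl)) (length-concatMap≤ f c xs (bound ∘ there)) ⟩
    c + length xs * c
  ∎
  where open ≤-Reasoning

length-basicSuffixes : ∀ {k} j {r} (vs : Vec (Word k) (suc r)) ws → length (basicSuffixes j vs ws) ≤ suc j ^ r
length-basicSuffixes j (v ∷ []) [] = s≤s z≤n
length-basicSuffixes {k} j {suc r} (v ∷ vs@(_ ∷ _)) (w ∷ ws) = begin
    length (concatMap (blockSuffixes j v w) R)
  ≤⟨ length-concatMap≤ (blockSuffixes j v w) (suc j) R (λ {y} _ → length-blockSuffixes j v w y) ⟩
    length R * suc j
  ≤⟨ *-monoˡ-≤ (suc j) (length-basicSuffixes j vs ws) ⟩
    suc j ^ r * suc j
  ≡⟨ *-comm (suc j ^ r) (suc j) ⟩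
    suc j ^ suc r
  ∎
  where
  open ≤-Reasoning
  R : List (Word k)
  R = basicSuffixes j vs ws

length-aridSuffixes : ∀ {k} j r (bs : List (Basic k)) → All (λ b → Basic.rank b ≤ r) bs →
  length (aridSuffixes j bs) ≤ length bs * suc j ^ r
length-aridSuffixes j r bs ranks =
  length-concatMap≤ _ (suc j ^ r) bs λ {b} b∈ →
    ≤-trans (length-basicSuffixes j (Basic.vs b) (Basic.ws b)) (^-monoʳ-≤ (suc j) (All-lookup ranks b∈))

∈-─ : ∀ {A : Set} {x z : A} {ys} (x∈ : x ∈ ys) → z ∈ ys → ¬ z ≡ x → z ∈ (ys ─ x∈)
∈-─ (here refl) (here refl) z≢x = ⊥-elim (z≢x refl)
∈-─ (here refl) (there z∈) z≢x = z∈
∈-─ (there x∈) (here refl) z≢x = here refl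
∈-─ (there x∈) (there z∈) z≢x = there (∈-─ x∈ z∈ z≢x)

unique-⊆⇒length≤ : ∀ {A : Set} (xs ys : List A) → Unique xs → (∀ {x} → x ∈ xs → x ∈ ys) →
  length xs ≤ length ys
unique-⊆⇒length≤ [] ys _ _ = z≤n
unique-⊆⇒length≤ (x ∷ xs) ys (x∉xs ∷ uxs) ⊆ys = begin
    suc (length xs)
  ≤⟨ s≤s (unique-⊆⇒length≤ xs (ys ─ x∈ys) uxs
            (λ z∈ → ∈-─ x∈ys (⊆ys (there z∈)) (λ z≡x → All-lookup x∉xs z∈ (sym z≡x)))) ⟩
    suc (length (ys ─ x∈ys))
  ≡⟨ sym (length-removeAt′ ys _) ⟩
    length ys
  ∎
  where
  open ≤-Reasoning
  x∈ys : x ∈ ys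
  x∈ys = ⊆ys (here refl)

-- Division by K

val-split : ∀ k j (u : Word k) → ∃ λ q → val k u ≡ val k (suffix j u) + q * k ^ j
val-split k j u with ≤-total j (length u)
... | inj₂ u≤j = 0 , sym (trans (+-identityʳ _) (cong (val k) (suffix-short j u u≤j)))
... | inj₁ j≤u = val k (take n u) , (begin
    val k u
  ≡⟨ cong (val k) (sym (take++drop≡id n u)) ⟩
    val k (take n u ++ suffix j u)
  ≡⟨ val-++ k (take n u) (suffix j u) ⟩
    val k (take n u) * k ^ length (suffix j u) + val k (suffix j u)
  ≡⟨ cong (λ e → val k (take n u) * k ^ e + val k (suffix j u)) (length-suffix-long j u j≤u) ⟩
    val k (take n u) * k ^ j + val k (suffix j u)
  ≡⟨ +-comm (val k (take n u) * k ^ j) (val k (suffix j u)) ⟩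
    val k (suffix j u) + val k (take n u) * k ^ j
  ∎)
  where
  open ≡-Reasoning
  n : ℕ
  n = length u ∸ j

quotient-in-window : ∀ K .{{_ : NonZero K}} {M N x} → N ≤ K → M ≤ x → x < M + N →
  x / K ≡ M / K ⊎ x / K ≡ suc (M / K)
quotient-in-window K {M} {N} {x} N≤K M≤x x<M+N with m≤n⇒m<n∨m≡n (/-monoˡ-≤ K M≤x)
... | inj₂ h≡q = inj₁ (sym h≡q)
... | inj₁ h<q = inj₂ (≤-antisym (≤-trans (/-monoˡ-≤ K x≤M+K) (≤-reflexive next-block)) h<q)
  where
  x≤M+K : x ≤ M + K
  x≤M+K = ≤-trans (<⇒≤ x<M+N) (+-monoʳ-≤ M N≤K)
  next-block : (M + K) / K ≡ suc (M / K)
  next-block = trans (m/n≡1+[m∸n]/n (m≤n+m K M)) (cong (λ z → suc (z / K)) (m+n∸n≡m M K))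

module _ (k : ℕ) .{{_ : NonZero k}} (j : ℕ) where

  private instance
    kʲ≢0 : NonZero (k ^ j)
    kʲ≢0 = m^n≢0 k j

  val-mod : ∀ (u : Word k) → val k u % k ^ j ≡ val k (suffix j u)
  val-mod u with val-split k j u
  ... | q , split = begin
      val k u % k ^ j
    ≡⟨ cong (_% k ^ j) split ⟩
      (val k (suffix j u) + q * k ^ j) % k ^ j
    ≡⟨ [m+kn]%n≡m%n (val k (suffix j u)) q (k ^ j) ⟩
      val k (suffix j u) % k ^ j
    ≡⟨ m<n⇒m%n≡m (<-≤-trans (val< k (suffix j u)) (^-monoʳ-≤ k (length-suffix≤ j u))) ⟩
      val k (suffix j u)
    ∎
    where open ≡-Reasoning

  window-bound : ∀ r (bs : List (Basic k)) → All (λ b → Basic.rank b ≤ r) bs →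
    (E : ℕ → Set) → (∀ n → E n → ∃ λ u → InArid bs u × val k u ≡ n) →
    ∀ M N → N ≤ k ^ j → CountInWindow≤ E M N (2 * (length bs * suc j ^ r))
  window-bound r bs ranks E covered M N N≤K xs unique inWindow =
    ≤-trans (unique-⊆⇒length≤ xs candidates unique (λ x∈ → candidate (All-lookup inWindow x∈)))
      (begin
        length candidates
      ≤⟨ length-concatMap≤ shiftBy (length residues) (h ∷ suc h ∷ [])
           (λ {q} _ → ≤-reflexive (length-map (λ s → s + q * K) residues)) ⟩
        2 * length residues
      ≡⟨ cong (2 *_) (length-map (val k) (aridSuffixes j bs)) ⟩
        2 * length (aridSuffixes j bs)
      ≤⟨ *-monoʳ-≤ 2 (length-aridSuffixes j r bs ranks) ⟩
        2 * (length bs * suc j ^ r)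
      ∎)
    where
    open ≤-Reasoning
    K : ℕ
    K = k ^ j
    h : ℕ
    h = M / K
    residues : List ℕ
    residues = map (val k) (aridSuffixes j bs)
    shiftBy : ℕ → List ℕ
    shiftBy q = map (λ s → s + q * K) residues
    candidates : List ℕ
    candidates = concatMap shiftBy (h ∷ suc h ∷ [])
    candidate : ∀ {x} → E x × M ≤ x × x < M + N → x ∈ candidates
    candidate (Ex , M≤x , x<M+N) with covered _ Ex
    ... | u , u∈ , refl =
      subst (_∈ candidates) (sym (m≡m%n+[m/n]*n x K))
        (∈-concatMap⁺ shiftBy (lose quotient∈ (∈-map⁺ (λ s → s + (x / K) * K) residue∈)))
      where
      x : ℕ
      x = val k u
      residue∈ : x % K ∈ residues
      residue∈ = subst (_∈ residues) (sym (val-mod u)) (∈-map⁺ (val k) (aridSuffixes-complete j bs u∈))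
      quotient∈ : x / K ∈ h ∷ suc h ∷ []
      quotient∈ = either here (there ∘ here) (quotient-in-window K N≤K M≤x x<M+N)

N<2^[1+⌊log₂N⌋] : ∀ N → N < 2 ^ suc ⌊log₂ N ⌋
N<2^[1+⌊log₂N⌋] N with 2 ^ suc ⌊log₂ N ⌋ ≤? N
... | no 2^≰N = ≰⇒> 2^≰N
... | yes 2^≤N = ⊥-elim (1+n≰n (subst (_≤ ⌊log₂ N ⌋) (⌊log₂[2^n]⌋≡n (suc ⌊log₂ N ⌋)) (⌊log₂⌋-mono-≤ 2^≤N)))

[2+L]^r≤3^r*L^r : ∀ L r → 1 ≤ L → suc (suc L) ^ r ≤ 3 ^ r * L ^ r
[2+L]^r≤3^r*L^r L zero 1≤L = ≤-refl
[2+L]^r≤3^r*L^r L (suc r) 1≤L = begin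
    suc (suc L) * suc (suc L) ^ r
  ≤⟨ *-mono-≤ 2+L≤3L ([2+L]^r≤3^r*L^r L r 1≤L) ⟩
    3 * L * (3 ^ r * L ^ r)
  ≡⟨ interchange 3 L (3 ^ r) (L ^ r) ⟩
    3 * 3 ^ r * (L * L ^ r)
  ∎
  where
  open ≤-Reasoning
  interchange : ∀ a b c d → a * b * (c * d) ≡ a * c * (b * d)
  interchange = solve-∀
  2+L≤3L : suc (suc L) ≤ 3 * L
  2+L≤3L = begin
      2 + L      ≡⟨ +-comm 2 L ⟩
      L + 2      ≤⟨ +-monoʳ-≤ L (*-monoʳ-≤ 2 1≤L) ⟩
      L + 2 * L  ∎

lemma3p6 : (k r : ℕ) → 2 ≤ k → (E : ℕ → Set) → IsAridRankExactly k r E →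
    ∃₂ λ (C N₀ : ℕ) → ∀ N → N₀ ≤ N → ∀ M → CountInWindow≤ E M N (C * ⌊log₂ N ⌋ ^ r)
lemma3p6 k r 2≤k E ((bs , ranks , describes) , _) = 2 * length bs * 3 ^ r , 2 , bound
  where
  instance
    k≢0 : NonZero k
    k≢0 = >-nonZero (≤-trans (s≤s z≤n) 2≤k)
  bound : ∀ N → 2 ≤ N → ∀ M → CountInWindow≤ E M N (2 * length bs * 3 ^ r * ⌊log₂ N ⌋ ^ r)
  bound N 2≤N M xs unique inWindow = begin
      length xs
    ≤⟨ window-bound k (suc L) r bs ranks E (λ n → proj₁ (describes n)) M N N≤kᴸ⁺¹ xs unique inWindow ⟩
      2 * (length bs * suc (suc L) ^ r)
    ≤⟨ *-monoʳ-≤ 2 (*-monoʳ-≤ (length bs) ([2+L]^r≤3^r*L^r L r 1≤L)) ⟩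
      2 * (length bs * (3 ^ r * L ^ r))
    ≡⟨ sym (trans (*-assoc (2 * length bs) (3 ^ r) (L ^ r)) (*-assoc 2 (length bs) (3 ^ r * L ^ r))) ⟩
      2 * length bs * 3 ^ r * L ^ r
    ∎
    where
    open ≤-Reasoning
    L : ℕ
    L = ⌊log₂ N ⌋
    1≤L : 1 ≤ L
    1≤L = subst (_≤ L) (⌊log₂[2^n]⌋≡n 1) (⌊log₂⌋-mono-≤ 2≤N)
    N≤kᴸ⁺¹ : N ≤ k ^ suc L
    N≤kᴸ⁺¹ = ≤-trans (<⇒≤ (N<2^[1+⌊log₂N⌋] N)) (^-monoˡ-≤ (suc L) 2≤k)
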